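{- Work in $\mathsf{ITT}$ with extensive coproducts satisfying strict $\eta$. For every type $I$ and $J:I\to\mathcal U$, every isomorphism in the wild category $\mathcal U^I_J$ is total.
   Context: $\mathsf{ITT}$: intensional Martin-Löf type theory with $\Sigma$, $\Pi$, identity types, binary coproducts, empty and unit types and a universe $\mathcal U$, strict $\beta$ and strict $\eta$ for $\Sigma$, $\Pi$, unit; coproducts satisfy strict $\eta$ and large elimination. $\mathcal U^I_J$ is the wild category with objects $A:I\to\mathcal U$, morphisms $\mathcal U^I_J(A,B):=\prod_{i:I}A(i)\to J(i)+B(i)$, identities $(\mathrm{id}_A)_i:=\mathrm{inc}_1$ and composition $(f\circ g)_i:=[\mathrm{inc}_0,f_i]\circ g_i$. A morphism $f:A\to B$ is an isomorphism if it has $s$ with a path $f\circ s=\mathrm{id}$ and $r$ with a path $r\circ f=\mathrm{id}$. $\mathrm{isInc}_1$ over $X+Y$ is $0$ on $\mathrm{inc}_0$ and $1$ on $\mathrm{inc}_1$; $h:\mathcal U^I_J(A,B)$ is total if $\prod_{i:I,a:A(i)}\mathrm{isInc}_1(h_ia)$ is inhabited. -}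

module Defs where

open import Data.Sum using (_⊎_; inj₁; inj₂; [_,_])
open import Data.Product using (Σ; _×_)
open import Data.Empty using (⊥)
open import Data.Unit using (⊤)
open import Relation.Binary.PropositionalEquality using (_≡_)

-- The wild category 𝒰^I_J.  Objects: families A : I → Set.
-- inc₀ = inj₁ (the J-summand), inc₁ = inj₂ (the B-summand).
Hom : {I : Set} (J : I → Set) (A B : I → Set) → Set
Hom {I} J A B = (i : I) → A i → J i ⊎ B i

idU : {I : Set} {J : I → Set} (A : I → Set) → Hom J A A
idU A i = inj₂

_∘U_ : {I : Set} {J : I → Set} {A B C : I → Set} →
       Hom J B C → Hom J A B → Hom J A C
(f ∘U g) i a = [ inj₁ , f i ] (g i a)

isIso : {I : Set} {J : I → Set} {A B : I → Set} → Hom J A B → Set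
isIso {J = J} {A} {B} f =
  Σ (Hom J B A) (λ s → (f ∘U s) ≡ idU B) ×
  Σ (Hom J B A) (λ r → (r ∘U f) ≡ idU A)

isInc₁ : {X Y : Set} → X ⊎ Y → Set
isInc₁ (inj₁ _) = ⊥
isInc₁ (inj₂ _) = ⊤

isTotal : {I : Set} {J : I → Set} {A B : I → Set} → Hom J A B → Set
isTotal {I} {A = A} h = (i : I) (a : A i) → isInc₁ (h i a)

{-# OPTIONS --safe #-}
module Submission where

open import Defs
open import Data.Sum using (_⊎_; inj₁; inj₂; [_,_]′)
open import Data.Product using (_,_)
open import Data.Unit using (tt)
open import Relation.Binary.PropositionalEquality using (_≡_; cong-app)

[inj₁,g]x≡inj₂⇒isInc₁ : {X Y Z : Set} (g : Y → X ⊎ Z) (x : X ⊎ Y) {z : Z} →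
                         [ inj₁ , g ]′ x ≡ inj₂ z → isInc₁ x
[inj₁,g]x≡inj₂⇒isInc₁ g (inj₁ _) ()
[inj₁,g]x≡inj₂⇒isInc₁ g (inj₂ _) _ = tt

retraction⇒isTotal : {I : Set} {J : I → Set} {A B : I → Set}
                     (f : Hom J A B) (r : Hom J B A) →
                     (r ∘U f) ≡ idU A → isTotal f
retraction⇒isTotal f r r∘f≡id i a =
  [inj₁,g]x≡inj₂⇒isInc₁ (r i) (f i a) (cong-app (cong-app r∘f≡id i) a)

corollary4p9 : (I : Set) (J : I → Set) (A B : I → Set) (f : Hom J A B) →
    isIso f → isTotal f
corollary4p9 I J A B f (_ , (r , r∘f≡id)) = retraction⇒isTotal f r r∘f≡id
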